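{- Let $n > 1$ be a positive integer. (i) If $F_n = D_n$ and $p$ is the largest prime divisor of $n$, then $F_{n/p} = D_{n/p}$ and $F_{np} = D_{np}$. (ii) If $F_n = D_n$ and $n+1$ is prime, then $F_{m} = D_{m}$ for $m = n(n+1)^k$, for every nonnegative integer $k$. (iii) If $n$ is a prime power pseudoperfect number and $n+1$ is prime, then $n(n+1)^k$ is a prime power pseudoperfect number for every nonnegative integer $k$. (iv) If $n$ is a prime power pseudoperfect number and $n-1$ is prime, then $n(n-1)$ is a prime power Giuga number.
   Context: For a composite positive integer $m$, let $d(m)$ denote the largest divisor of $m$ strictly between $1$ and $m$. Define $f$ on integers $m > 1$ by $f(m) = m - 1$ if $m$ is prime and $f(m) = m - d(m)$ if $m$ is composite. Let $f^{(0)}(m) = m$ and $f^{(i)} = f\circ f^{(i-1)}$. For $m>1$, let $F_m = \{m, f(m), f^{(2)}(m), \dots, 1\}$ be the set of values obtained by iterating $f$ from $m$ until $1$ is reached, and set $F_1 = \{1\}$. Let $D_m$ be the set of positive divisors of $m$. (The integers $m$ with $F_m = D_m$ form OEIS sequence A073935, which includes $1$.) A prime power pseudoperfect number is an integer $n>1$ with $\sum_{p^k \mid n} \frac{1}{p^k} + \frac{1}{n} = 1$, and a prime power Giuga number is a composite integer $n>1$ with $\sum_{p^k \mid n} \frac{1}{p^k} - \frac{1}{n} \in \mathbb{N}$; in both, the sum is over all prime powers $p^k$ ($p$ prime, $k\ge1$) dividing $n$. -}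

module Defs where

open import Data.Nat using (ℕ; zero; suc; _∸_; _^_; _<_; _≟_)
open import Data.Nat.Divisibility using (_∣_; _∣?_)
open import Data.Nat.Primality using (Prime; prime?)
open import Data.Bool using (Bool; if_then_else_; _∧_)
open import Data.List using (upTo)
open import Data.Bool.ListAction using (any)
open import Data.Empty using (⊥)
open import Data.Nat.Primality using (Composite)
open import Data.Integer using (+_)
open import Data.Rational using (ℚ; _/_; _+_; _-_; 0ℚ; 1ℚ)
open import Data.Product using (Σ; _×_)
open import Relation.Nullary using (¬_; does)
open import Relation.Binary.PropositionalEquality using (_≡_)

largestDivUpTo : ℕ → ℕ → ℕ
largestDivUpTo m zero = 0
largestDivUpTo m (suc k) = if does (suc k ∣? m) then suc k else largestDivUpTo m k

-- d(m): the largest divisor of m strictly below m; for composite m this is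
-- the largest divisor strictly between 1 and m (only used for composite m)
d : ℕ → ℕ
d m = largestDivUpTo m (m ∸ 1)

f : ℕ → ℕ
f m = if does (prime? m) then m ∸ 1 else m ∸ d m

iter : ℕ → ℕ → ℕ
iter zero m = m
iter (suc i) m = f (iter i m)

InF : ℕ → ℕ → Set
InF m x = Σ ℕ (λ i → (iter i m ≡ x) × (∀ j → j < i → ¬ (iter j m ≡ 1)))

FeqD : ℕ → Set
FeqD m = (∀ x → InF m x → x ∣ m) × (∀ x → x ∣ m → InF m x)

-- q is a prime power p^k with p prime, k ≥ 1 (p ≤ q and k ≤ q suffice for the search)
isPrimePower : ℕ → Bool
isPrimePower q =
  any (λ p → any (λ k → does (prime? p) ∧ does ((p ^ suc k) ≟ q)) (upTo q)) (upTo (suc q))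

ppSumUpTo : ℕ → ℕ → ℚ
ppSumUpTo n zero = 0ℚ
ppSumUpTo n (suc k) =
  (if isPrimePower (suc k) ∧ does (suc k ∣? n) then (+ 1) / suc k else 0ℚ)
  + ppSumUpTo n k

ppSum : ℕ → ℚ
ppSum n = ppSumUpTo n n

PPPseudoperfect : ℕ → Set
PPPseudoperfect zero = ⊥
PPPseudoperfect (suc zero) = ⊥
PPPseudoperfect (suc (suc k)) = ppSum (suc (suc k)) + (+ 1) / suc (suc k) ≡ 1ℚ

PPGiuga : ℕ → Set
PPGiuga zero = ⊥
PPGiuga (suc zero) = ⊥
PPGiuga (suc (suc k)) =
  Composite (suc (suc k)) ×
  Σ ℕ (λ t → ppSum (suc (suc k)) - (+ 1) / suc (suc k) ≡ (+ t) / 1)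

{-# OPTIONS --safe #-}
-- For m > 1 with least prime factor p one has d m = m / p, hence f m = (m / p) (p - 1).
-- So f (y q^j) = f y q^j whenever y has a prime factor below the prime q, and the orbit
-- of y q^j runs through the orbit of y scaled by q^j until it reaches q^j.  If q = m + 1
-- and F_m = D_m, then f (q^(b+1)) = m q^b, and induction on b gives
-- F_(m q^b) = { z q^j : z ∈ F_m, j ≤ b } = D_(m q^b): this is (ii).  For (i) write
-- n = m p^(a+1) with p ∤ m; every z with z p^(a+1) on the orbit of n divides m, so its least
-- prime factor is below p, and the same description of F_n yields F_m = D_m.  Moreover
-- (p - 1) p^a ∈ F_n = D_n gives p - 1 ∣ m, while m p^a ∈ D_n = F_n forces m p^a ≤ (p - 1) p^a;
-- hence p = m + 1 and (i) follows from (ii).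
-- For (iii) and (iv): the prime powers dividing n q^(k+1) are those dividing n q^k together
-- with q^(k+1) (q prime, q ∤ n), and 1/q^(k+1) + 1/(n q^(k+1)) = 1/(n q^k) when q = n + 1.
module Submission where

open import Defs

open import Data.Bool using (Bool; true; false; T; if_then_else_; _∧_)
open import Data.Bool.Properties using (T-∧; T-≡; ∧-zeroʳ)
import Data.Integer as ℤ
import Data.Integer.Properties as ℤ
open import Data.List using (upTo)
open import Data.List.Membership.Propositional using (lose)
open import Data.List.Membership.Propositional.Properties using (∈-upTo⁺)
open import Data.List.Relation.Unary.Any using (satisfied)
open import Data.List.Relation.Unary.Any.Properties using (any⁺; any⁻)
open import Data.Nat
open import Data.Nat.Coprimality as Coprime using (Coprime; coprime-divisor; coprime-+; 1-coprimeTo)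
open import Data.Nat.Divisibility
open import Data.Nat.Induction using (<-rec)
open import Data.Nat.Primality
open import Data.Nat.Properties
open import Data.Nat.Tactic.RingSolver using (solve-∀)
open import Data.Product using (∃-syntax; _×_; _,_; proj₁; proj₂)
open import Data.Rational as ℚ using (ℚ; 0ℚ; 1ℚ)
import Data.Rational.Properties as ℚ
import Data.Rational.Unnormalised as ℚᵘ
import Data.Rational.Unnormalised.Properties as ℚᵘ
open import Data.Sum using (_⊎_; inj₁; inj₂; [_,_]′)
open import Function using (_∘_; id)
open import Function.Bundles using (_⇔_; mk⇔; Equivalence)
open import Relation.Binary.PropositionalEquality
open import Relation.Nullary using (¬_; Dec; does; yes; no; contradiction)
open import Relation.Nullary.Decidable using (dec-true; dec-false; does-⇔)

open import Algebra.Properties.CommutativeSemigroup *-commutativeSemigroup using (xy∙z≈xz∙y)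
open import Algebra.Properties.AbelianGroup ℚ.+-0-abelianGroup using (xyx⁻¹≈y)

private
  variable
    c e j k m n n′ p q r s x y z : ℕ

-- Largest proper divisors

largestDivUpTo-yes : suc k ∣ m → largestDivUpTo m (suc k) ≡ suc k
largestDivUpTo-yes {k} {m} k+1∣m =
  cong (λ b → if b then suc k else largestDivUpTo m k) (dec-true (suc k ∣? m) k+1∣m)

largestDivUpTo-no : ¬ suc k ∣ m → largestDivUpTo m (suc k) ≡ largestDivUpTo m k
largestDivUpTo-no {k} {m} k+1∤m =
  cong (λ b → if b then suc k else largestDivUpTo m k) (dec-false (suc k ∣? m) k+1∤m)

largestDivUpTo-∣ : ∀ m k → largestDivUpTo m (suc k) ∣ m
largestDivUpTo-∣ m k with suc k ∣? m
... | yes k+1∣m rewrite largestDivUpTo-yes k+1∣m = k+1∣m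
largestDivUpTo-∣ m zero    | no 1∤m = contradiction (1∣ m) 1∤m
largestDivUpTo-∣ m (suc k) | no k+2∤m rewrite largestDivUpTo-no k+2∤m = largestDivUpTo-∣ m k

largestDivUpTo-≤ : ∀ m k → largestDivUpTo m k ≤ k
largestDivUpTo-≤ m zero = z≤n
largestDivUpTo-≤ m (suc k) with suc k ∣? m
... | yes k+1∣m rewrite largestDivUpTo-yes k+1∣m = ≤-refl
... | no k+1∤m rewrite largestDivUpTo-no k+1∤m = m≤n⇒m≤1+n (largestDivUpTo-≤ m k)

largestDivUpTo-largest : ∀ m k → x ∣ m → x ≤ k → x ≤ largestDivUpTo m k
largestDivUpTo-largest m zero x∣m x≤0 = x≤0
largestDivUpTo-largest {x} m (suc k) x∣m x≤k+1 with suc k ∣? m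
... | yes k+1∣m rewrite largestDivUpTo-yes k+1∣m = x≤k+1
... | no k+1∤m rewrite largestDivUpTo-no k+1∤m with m≤n⇒m<n∨m≡n x≤k+1
...   | inj₁ x<k+1 = largestDivUpTo-largest m k x∣m (≤-pred x<k+1)
...   | inj₂ refl  = contradiction x∣m k+1∤m

d∣ : 1 < m → d m ∣ m
d∣ {suc (suc k)} (s≤s (s≤s _)) = largestDivUpTo-∣ _ k

d< : 1 < m → d m < m
d< {suc (suc k)} (s≤s (s≤s _)) = s≤s (largestDivUpTo-≤ _ (suc k))

d-largest : 1 < m → x ∣ m → x < m → x ≤ d m
d-largest {suc (suc k)} (s≤s (s≤s _)) x∣m x<m = largestDivUpTo-largest _ (suc k) x∣m (≤-pred x<m)

∣⇒>0 : 0 < n → x ∣ n → 0 < x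
∣⇒>0 {x = zero}  0<n 0∣n = contradiction (0∣⇒≡0 0∣n) (>⇒≢ 0<n)
∣⇒>0 {x = suc _} _   _   = z<s

0<d : 1 < m → 0 < d m
0<d 1<m = ∣⇒>0 (m<n⇒0<n 1<m) (d∣ 1<m)

f≡∸d : 1 < m → f m ≡ m ∸ d m
f≡∸d {m} 1<m with prime? m
... | no _ = refl
... | yes pm with prime⇒irreducible pm (d∣ 1<m)
...   | inj₁ dm≡1 = cong (m ∸_) (sym dm≡1)
...   | inj₂ dm≡m = contradiction dm≡m (<⇒≢ (d< 1<m))

f< : 1 < m → f m < m
f< {m} 1<m rewrite f≡∸d 1<m = ∸-monoʳ-< (0<d 1<m) (<⇒≤ (d< 1<m))

0<f : 1 < m → 0 < f m
0<f 1<m rewrite f≡∸d 1<m = m<n⇒0<n∸m (d< 1<m)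

record LeastFactor (m p : ℕ) : Set where
  field
    nontrivial : 1 < p
    factor     : p ∣ m
    least      : ∀ {g} → 1 < g → g ∣ m → p ≤ g

open LeastFactor

leastFactor-unique : LeastFactor m p → LeastFactor m q → p ≡ q
leastFactor-unique lp lq =
  ≤-antisym (least lp (nontrivial lq) (factor lq)) (least lq (nontrivial lp) (factor lp))

leastFactor⇒prime : LeastFactor m p → Prime p
leastFactor⇒prime {p = p} lf = irreducible⇒prime {{n>1⇒nonTrivial (nontrivial lf)}} irreducible
  where
  instance _ = >-nonZero (m<n⇒0<n (nontrivial lf))
  irreducible : Irreducible p
  irreducible {zero} 0∣p = contradiction (0∣⇒≡0 0∣p) (≢-nonZero⁻¹ p)
  irreducible {1} _ = inj₁ refl
  irreducible {suc (suc e)} e∣p =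
    inj₂ (≤-antisym (∣⇒≤ e∣p) (least lf (s≤s (s≤s z≤n)) (∣-trans e∣p (factor lf))))

m/d-leastFactor : 1 < m → ∃[ p ] LeastFactor m p × d m * p ≡ m
m/d-leastFactor {m} 1<m = g , lf , trans (*-comm (d m) g) (sym (m∣n⇒n≡quotient*m d∣m))
  where
  instance
    _ = >-nonZero (m<n⇒0<n 1<m)
    _ = >-nonZero (0<d 1<m)
  d∣m = d∣ 1<m
  g = quotient d∣m
  g-least : ∀ {h} → 1 < h → h ∣ m → g ≤ h
  g-least {h} 1<h h∣m = *-cancelʳ-≤ g h (d m) (begin
    g * d m ≡⟨ m∣n⇒n≡quotient*m d∣m ⟨
    m       ≡⟨ m∣n⇒n≡quotient*m h∣m ⟩
    u * h   ≤⟨ *-monoˡ-≤ h u≤d ⟩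
    d m * h ≡⟨ *-comm (d m) h ⟩
    h * d m ∎)
    where
    open ≤-Reasoning
    instance _ = n>1⇒nonTrivial 1<h
    u = quotient h∣m
    u≤d : u ≤ d m
    u≤d = d-largest 1<m (quotient-∣ h∣m) (quotient-< h∣m)
  lf : LeastFactor m g
  lf = record { nontrivial = quotient>1 d∣m (d< 1<m) ; factor = quotient-∣ d∣m ; least = g-least }

leastFactor-exists : 1 < m → ∃[ p ] LeastFactor m p
leastFactor-exists 1<m with p , lf , _ ← m/d-leastFactor 1<m = p , lf

d*leastFactor≡ : 1 < m → LeastFactor m p → d m * p ≡ m
d*leastFactor≡ 1<m lp with q , lq , dq≡m ← m/d-leastFactor 1<m
  rewrite leastFactor-unique lp lq = dq≡m

f-leastFactor : 1 < c * p → LeastFactor (c * p) p → f (c * p) ≡ c * (p ∸ 1)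
f-leastFactor {c} {p} 1<cp lf = begin
  f (c * p)         ≡⟨ f≡∸d 1<cp ⟩
  c * p ∸ d (c * p) ≡⟨ cong (c * p ∸_) d≡c ⟩
  c * p ∸ c * 1     ≡⟨ *-distribˡ-∸ c p 1 ⟨
  c * (p ∸ 1)       ∎
  where
  open ≡-Reasoning
  instance _ = >-nonZero (m<n⇒0<n (nontrivial lf))
  d≡c : d (c * p) ≡ c * 1
  d≡c = trans (*-cancelʳ-≡ _ c p (d*leastFactor≡ 1<cp lf)) (sym (*-identityʳ c))

prime>1 : Prime p → 1 < p
prime>1 {p} pp = nonTrivial⇒n>1 p {{prime⇒nonTrivial pp}}

prime∣prime⇒≡ : Prime q → Prime r → r ∣ q → r ≡ q
prime∣prime⇒≡ pq pr r∣q with prime⇒irreducible pq r∣q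
... | inj₁ r≡1 = contradiction r≡1 (>⇒≢ (prime>1 pr))
... | inj₂ r≡q = r≡q

prime∣^⇒≡ : ∀ {j} → Prime q → Prime r → r ∣ q ^ j → r ≡ q
prime∣^⇒≡ {j = zero} _ pr r∣1 = contradiction (∣1⇒≡1 r∣1) (>⇒≢ (prime>1 pr))
prime∣^⇒≡ {q} {j = suc j} pq pr r∣q^j+1 with euclidsLemma q (q ^ j) pr r∣q^j+1
... | inj₁ r∣q   = prime∣prime⇒≡ pq pr r∣q
... | inj₂ r∣q^j = prime∣^⇒≡ {j = j} pq pr r∣q^j

leastFactor-byPrimes : 1 < p → p ∣ m → (∀ {r} → Prime r → r ∣ m → p ≤ r) → LeastFactor m p
leastFactor-byPrimes {p} {m} 1<p p∣m below-primes = record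
  { nontrivial = 1<p ; factor = p∣m ; least = least-nontrivial }
  where
  least-nontrivial : ∀ {g} → 1 < g → g ∣ m → p ≤ g
  least-nontrivial 1<g g∣m with r , lr ← leastFactor-exists 1<g =
    ≤-trans (below-primes (leastFactor⇒prime lr) (∣-trans (factor lr) g∣m))
            (∣⇒≤ {{>-nonZero (m<n⇒0<n 1<g)}} (factor lr))

leastFactor-*ʳ : LeastFactor m p → (∀ {r} → Prime r → r ∣ n → p ≤ r) → LeastFactor (m * n) p
leastFactor-*ʳ {m} {p} {n} lf below-primes =
  leastFactor-byPrimes (nontrivial lf) (∣m⇒∣m*n n (factor lf)) λ {r} pr r∣mn →
    [ least lf (prime>1 pr) , below-primes pr ]′ (euclidsLemma m n pr r∣mn)

leastFactor-^ : Prime q → LeastFactor (q ^ suc j) q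
leastFactor-^ {q} {j} pq =
  leastFactor-byPrimes (prime>1 pq) (m∣m*n (q ^ j)) λ pr r∣q^j+1 →
    ≤-reflexive (sym (prime∣^⇒≡ {j = suc j} pq pr r∣q^j+1))

f-*ʳ : 1 < m → 0 < n → LeastFactor m p → (∀ {r} → Prime r → r ∣ n → p ≤ r) →
       f (m * n) ≡ f m * n
f-*ʳ {m} {n} {p} 1<m 0<n lf below-primes with divides-refl c ← factor lf = begin
  f (c * p * n)     ≡⟨ cong f (xy∙z≈xz∙y c p n) ⟩
  f (c * n * p)     ≡⟨ f-leastFactor {c * n} 1<cnp lf′ ⟩
  c * n * (p ∸ 1)   ≡⟨ xy∙z≈xz∙y c n (p ∸ 1) ⟩
  c * (p ∸ 1) * n   ≡⟨ cong (_* n) (f-leastFactor {c} 1<m lf) ⟨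
  f (c * p) * n     ∎
  where
  open ≡-Reasoning
  lf′ : LeastFactor (c * n * p) p
  lf′ = subst (λ x → LeastFactor x p) (xy∙z≈xz∙y c p n) (leastFactor-*ʳ lf below-primes)
  1<cnp : 1 < c * n * p
  1<cnp = subst (1 <_) (xy∙z≈xz∙y c p n) (<-≤-trans 1<m (m≤m*n _ n {{>-nonZero 0<n}}))

prime^suc>1 : Prime q → 1 < q ^ suc j
prime^suc>1 {q} {j} pq = <-≤-trans (prime>1 pq) (m≤m*n q (q ^ j) {{m^n≢0 q j {{prime⇒nonZero pq}}}})

f-^ : Prime q → f (q ^ suc j) ≡ (q ∸ 1) * q ^ j
f-^ {q} {j} pq = begin
  f (q * q ^ j)     ≡⟨ cong f (*-comm q (q ^ j)) ⟩
  f (q ^ j * q)     ≡⟨ f-leastFactor {q ^ j} 1<q^j*q lf ⟩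
  q ^ j * (q ∸ 1)   ≡⟨ *-comm (q ^ j) (q ∸ 1) ⟩
  (q ∸ 1) * q ^ j   ∎
  where
  open ≡-Reasoning
  lf : LeastFactor (q ^ j * q) q
  lf = subst (λ x → LeastFactor x q) (*-comm q (q ^ j)) (leastFactor-^ {j = j} pq)
  1<q^j*q : 1 < q ^ j * q
  1<q^j*q = subst (1 <_) (*-comm q (q ^ j)) (prime^suc>1 {j = j} pq)

-- Orbits of f

iter-f : ∀ i m → iter i (f m) ≡ iter (suc i) m
iter-f zero    m = refl
iter-f (suc i) m = cong f (iter-f i m)

InF-resp : m ≡ n → InF m x → InF n x
InF-resp refl x∈F = x∈F

InF-start : InF m m
InF-start = 0 , refl , λ _ ()

InF-step : 1 < m → InF (f m) x → InF m x
InF-step {m} 1<m (i , fᶦfm≡x , before) = suc i , trans (sym (iter-f i m)) fᶦfm≡x , not-yet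
  where
  not-yet : ∀ j → j < suc i → iter j m ≢ 1
  not-yet zero    _         m≡1 = >⇒≢ 1<m m≡1
  not-yet (suc j) (s≤s j<i) eq  = before j j<i (trans (iter-f j m) eq)

InF-split : InF m x → x ≡ m ⊎ InF (f m) x
InF-split (zero  , m≡x , _) = inj₁ (sym m≡x)
InF-split {m} (suc i , eq , before) =
  inj₂ (i , trans (iter-f i m) eq , λ j j<i eq′ →
    before (suc j) (s≤s j<i) (trans (sym (iter-f j m)) eq′))

InF-1 : InF 1 x → x ≡ 1
InF-1 (zero  , 1≡x , _)    = sym 1≡x
InF-1 (suc _ , _ , before) = contradiction refl (before 0 z<s)

f-induction : (P : ℕ → Set) → P 1 → (∀ {m} → 1 < m → P (f m) → P m) →
              ∀ {m} → 0 < m → P m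
f-induction P base step {m} = <-rec (λ m → 0 < m → P m) go m
  where
  go : ∀ m → (∀ {k} → k < m → 0 < k → P k) → 0 < m → P m
  go (suc zero)          _  _ = base
  go m@(suc (suc _)) below _ = step 1<m (below (f< 1<m) (0<f 1<m))
    where 1<m = s≤s (s≤s z≤n)

InF-≤ : 0 < m → InF m x → x ≤ m
InF-≤ 0<m = f-induction (λ m → ∀ {x} → InF m x → x ≤ m) (≤-reflexive ∘ InF-1) step 0<m
  where
  step : ∀ {m} → 1 < m → (∀ {x} → InF (f m) x → x ≤ f m) → ∀ {x} → InF m x → x ≤ m
  step 1<m ih x∈Fm with InF-split x∈Fm
  ... | inj₁ refl  = ≤-refl
  ... | inj₂ x∈Ffm = ≤-trans (ih x∈Ffm) (<⇒≤ (f< 1<m))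

InF-reaches-1 : 0 < m → InF m 1
InF-reaches-1 = f-induction (λ m → InF m 1) InF-start InF-step

InF-trans : 0 < m → InF m z → InF z x → InF m x
InF-trans 0<m = f-induction (λ m → ∀ {z x} → InF m z → InF z x → InF m x) base step 0<m
  where
  base : InF 1 z → InF z x → InF 1 x
  base z∈F1 x∈Fz rewrite InF-1 z∈F1 = x∈Fz
  step : ∀ {m} → 1 < m → (∀ {z x} → InF (f m) z → InF z x → InF (f m) x) →
         ∀ {z x} → InF m z → InF z x → InF m x
  step 1<m ih z∈Fm x∈Fz with InF-split z∈Fm
  ... | inj₁ refl  = x∈Fz
  ... | inj₂ z∈Ffm = InF-step 1<m (ih z∈Ffm x∈Fz)

FactorBelow : ℕ → ℕ → Set
FactorBelow q z = ∃[ p ] LeastFactor z p × p < q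

f-*^ : Prime q → 1 < z → FactorBelow q z → f (z * q ^ j) ≡ f z * q ^ j
f-*^ {q} {j = j} pq 1<z (p , lf , p<q) = f-*ʳ 1<z (m^n>0 q {{prime⇒nonZero pq}} j) lf λ pr r∣q^j →
  ≤-trans (<⇒≤ p<q) (≤-reflexive (sym (prime∣^⇒≡ {j = j} pq pr r∣q^j)))

module OrbitOfMultiple {q} (pq : Prime q) (j : ℕ) where

  0<q^j : 0 < q ^ j
  0<q^j = m^n>0 q {{prime⇒nonZero pq}} j

  -- Under this hypothesis f acts on the cofactor alone along the orbit of y q^j.
  CofactorsBelow : ℕ → Set
  CofactorsBelow y = ∀ {z} → 1 < z → InF (y * q ^ j) (z * q ^ j) → FactorBelow q z

  f-*q^ : 1 < y → CofactorsBelow y → f (y * q ^ j) ≡ f y * q ^ j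
  f-*q^ 1<y below = f-*^ {j = j} pq 1<y (below 1<y InF-start)

  1<*q^ : 1 < y → 1 < y * q ^ j
  1<*q^ {y} 1<y = <-≤-trans 1<y (m≤m*n y (q ^ j) {{>-nonZero 0<q^j}})

  cofactorsBelow-f : 1 < y → CofactorsBelow y → CofactorsBelow (f y)
  cofactorsBelow-f {y} 1<y below 1<z z∈F =
    below 1<z (InF-step (1<*q^ 1<y) (InF-resp (sym (f-*q^ 1<y below)) z∈F))

  InF-*q^⁻ : 0 < y → CofactorsBelow y → InF (y * q ^ j) x →
             (∃[ z ] InF y z × x ≡ z * q ^ j) ⊎ InF (q ^ j) x
  InF-*q^⁻ 0<y below x∈F = f-induction Goal base step 0<y below x∈F
    where
    Goal : ℕ → Set
    Goal y = CofactorsBelow y → ∀ {x} → InF (y * q ^ j) x →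
             (∃[ z ] InF y z × x ≡ z * q ^ j) ⊎ InF (q ^ j) x
    base : Goal 1
    base _ x∈F = inj₂ (InF-resp (*-identityˡ (q ^ j)) x∈F)
    step : ∀ {y} → 1 < y → Goal (f y) → Goal y
    step {y} 1<y ih below x∈F with InF-split x∈F
    ... | inj₁ x≡ = inj₁ (y , InF-start , x≡)
    ... | inj₂ x∈Ff with ih (cofactorsBelow-f 1<y below) (InF-resp (f-*q^ 1<y below) x∈Ff)
    ...   | inj₁ (z , z∈Ffy , x≡) = inj₁ (z , InF-step 1<y z∈Ffy , x≡)
    ...   | inj₂ x∈Fq^j           = inj₂ x∈Fq^j

  InF-*q^⁺ : 0 < y → CofactorsBelow y → InF y z → InF (y * q ^ j) (z * q ^ j)
  InF-*q^⁺ 0<y below z∈F = f-induction Goal base step 0<y below z∈F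
    where
    Goal : ℕ → Set
    Goal y = CofactorsBelow y → ∀ {z} → InF y z → InF (y * q ^ j) (z * q ^ j)
    base : Goal 1
    base _ z∈F1 rewrite InF-1 z∈F1 = InF-start
    step : ∀ {y} → 1 < y → Goal (f y) → Goal y
    step {y} 1<y ih below z∈F with InF-split z∈F
    ... | inj₁ refl  = InF-start
    ... | inj₂ z∈Ffy = InF-step (1<*q^ 1<y)
      (InF-resp (sym (f-*q^ 1<y below)) (ih (cofactorsBelow-f 1<y below) z∈Ffy))

  InF-*q^-tail : 0 < y → CofactorsBelow y → InF (q ^ j) x → InF (y * q ^ j) x
  InF-*q^-tail {y} 0<y below x∈F = InF-trans (*-mono-≤ 0<y 0<q^j) q^j∈F x∈F
    where
    q^j∈F : InF (y * q ^ j) (q ^ j)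
    q^j∈F = subst (InF (y * q ^ j)) (*-identityˡ (q ^ j)) (InF-*q^⁺ 0<y below (InF-reaches-1 0<y))

*^-suc : ∀ m q a → m * q ^ suc a ≡ m * q ^ a * q
*^-suc m q a = trans (cong (m *_) (*-comm q (q ^ a))) (sym (*-assoc m (q ^ a) q))

split-^ : Prime q → 0 < n → ∃[ m ] ∃[ a ] ¬ q ∣ m × n ≡ m * q ^ a
split-^ {q} pq = <-rec (λ n → 0 < n → ∃[ m ] ∃[ a ] ¬ q ∣ m × n ≡ m * q ^ a) go _
  where
  go : ∀ n → (∀ {t} → t < n → 0 < t → ∃[ m ] ∃[ a ] ¬ q ∣ m × t ≡ m * q ^ a) →
       0 < n → ∃[ m ] ∃[ a ] ¬ q ∣ m × n ≡ m * q ^ a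
  go n below 0<n with q ∣? n
  ... | no q∤n = n , 0 , q∤n , sym (*-identityʳ n)
  ... | yes q∣n = divide-out (below (quotient-< q∣n) 0<t)
    where
    instance
      _ = >-nonZero 0<n
      _ = prime⇒nonTrivial pq
    t = quotient q∣n
    0<t = >-nonZero⁻¹ t {{quotient≢0 q∣n}}
    divide-out : ∃[ m ] ∃[ a ] ¬ q ∣ m × t ≡ m * q ^ a → ∃[ m ] ∃[ a ] ¬ q ∣ m × n ≡ m * q ^ a
    divide-out (m , a , q∤m , t≡) =
      m , suc a , q∤m , trans (m∣n⇒n≡quotient*m q∣n) (trans (cong (_* q) t≡) (sym (*^-suc m q a)))

coprime-^ : ∀ b → Prime q → ¬ q ∣ z → Coprime z (q ^ b)
coprime-^ {q} b pq q∤z {zero} (_ , 0∣q^b) =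
  contradiction (0∣⇒≡0 0∣q^b) (≢-nonZero⁻¹ (q ^ b) {{m^n≢0 q b {{prime⇒nonZero pq}}}})
coprime-^ b pq q∤z {1} _ = refl
coprime-^ b pq q∤z {i@(suc (suc _))} (i∣z , i∣q^b)
  with r , lr ← leastFactor-exists {i} (s≤s (s≤s z≤n)) = contradiction q∣z q∤z
  where
  q∣z = subst (_∣ _) (prime∣^⇒≡ {j = b} pq (leastFactor⇒prime lr) (∣-trans (factor lr) i∣q^b))
                     (∣-trans (factor lr) i∣z)

^-monoʳ-∣ : ∀ q {j b} → j ≤ b → q ^ j ∣ q ^ b
^-monoʳ-∣ q {j} {b} j≤b = divides (q ^ (b ∸ j)) (begin
  q ^ b               ≡⟨ cong (q ^_) (m+[n∸m]≡n j≤b) ⟨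
  q ^ (j + (b ∸ j))   ≡⟨ ^-distribˡ-+-* q j (b ∸ j) ⟩
  q ^ j * q ^ (b ∸ j) ≡⟨ *-comm (q ^ j) (q ^ (b ∸ j)) ⟩
  q ^ (b ∸ j) * q ^ j ∎)
  where open ≡-Reasoning

¬∣⇒>0 : ¬ q ∣ m → 0 < m
¬∣⇒>0 {q} {zero} q∤0 = contradiction (q ∣0) q∤0
¬∣⇒>0 {m = suc _} _ = z<s

∣*^⇒ : ∀ b → Prime q → ¬ q ∣ m → x ∣ m * q ^ b →
       ∃[ z ] ∃[ j ] z ∣ m × j ≤ b × x ≡ z * q ^ j
∣*^⇒ {q} {m} {x} b pq q∤m x∣m*q^b
  with split-^ pq (∣⇒>0 (*-mono-≤ (¬∣⇒>0 q∤m) (m^n>0 q {{prime⇒nonZero pq}} b)) x∣m*q^b)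
... | z , j , q∤z , x≡z*q^j = z , j , z∣m , j≤b , x≡z*q^j
  where
  instance _ = m^n≢0 q b {{prime⇒nonZero pq}}
  z∣x : z ∣ x
  z∣x = divides (q ^ j) (trans x≡z*q^j (*-comm z (q ^ j)))
  z∣m : z ∣ m
  z∣m = coprime-divisor (coprime-^ b pq q∤z) (subst (z ∣_) (*-comm m (q ^ b)) (∣-trans z∣x x∣m*q^b))
  j≤b : j ≤ b
  j≤b with j ≤? b
  ... | yes j≤b = j≤b
  ... | no  j≰b = contradiction (*-cancelʳ-∣ (q ^ b) q^b+1∣m*q^b) q∤m
    where
    q^b+1∣m*q^b : q * q ^ b ∣ m * q ^ b
    q^b+1∣m*q^b = ∣-trans (^-monoʳ-∣ q (≰⇒> j≰b)) (∣-trans (divides z x≡z*q^j) x∣m*q^b)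

-- Orbits of m (m + 1)^b for prime m + 1

module SuccessorPrime {m} (F≡D : FeqD m) (pq : Prime (suc m)) where

  private
    open OrbitOfMultiple pq
    instance _ = >-nonZero (≤-pred (prime>1 pq))

  0<m : 0 < m
  0<m = >-nonZero⁻¹ m

  m+1∤m : ¬ suc m ∣ m
  m+1∤m = >⇒∤ ≤-refl

  cofactorsBelow : ∀ b → CofactorsBelow b m
  cofactorsBelow b {z} 1<z z*q^b∈F with p , lp ← leastFactor-exists 1<z =
    p , lp , s≤s (≤-trans (∣⇒≤ {{>-nonZero (m<n⇒0<n 1<z)}} (factor lp)) z≤m)
    where
    z≤m : z ≤ m
    z≤m = *-cancelʳ-≤ z m (suc m ^ b) {{m^n≢0 (suc m) b}} (InF-≤ (*-mono-≤ 0<m (0<q^j b)) z*q^b∈F)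

  InF-*q^suc⁻ : ∀ b → InF (m * suc m ^ suc b) x →
                (∃[ z ] InF m z × x ≡ z * suc m ^ suc b) ⊎ InF (m * suc m ^ b) x
  InF-*q^suc⁻ b x∈F with InF-*q^⁻ (suc b) 0<m (cofactorsBelow (suc b)) x∈F
  ... | inj₁ on-multiple = inj₁ on-multiple
  ... | inj₂ x∈Fq^b+1 with InF-split x∈Fq^b+1
  ...   | inj₁ refl   = inj₁ (1 , InF-reaches-1 0<m , sym (*-identityˡ (suc m ^ suc b)))
  ...   | inj₂ x∈Ffq^b+1 = inj₂ (InF-resp (f-^ {j = b} pq) x∈Ffq^b+1)

  InF-*q^suc⁺ : ∀ b → InF (m * suc m ^ b) x → InF (m * suc m ^ suc b) x
  InF-*q^suc⁺ b x∈F = InF-*q^-tail (suc b) 0<m (cofactorsBelow (suc b))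
    (InF-step (prime^suc>1 {j = b} pq)
      (InF-resp (sym (f-^ {j = b} pq)) x∈F))

  ScaledOrbit : ℕ → ℕ → Set
  ScaledOrbit b x = ∃[ z ] ∃[ j ] InF m z × j ≤ b × x ≡ z * suc m ^ j

  InF⇒scaledOrbit : ∀ b → InF (m * suc m ^ b) x → ScaledOrbit b x
  InF⇒scaledOrbit {x} zero x∈F = x , 0 , InF-resp (*-identityʳ m) x∈F , z≤n , sym (*-identityʳ x)
  InF⇒scaledOrbit (suc b) x∈F with InF-*q^suc⁻ b x∈F
  ... | inj₁ (z , z∈F , x≡) = z , suc b , z∈F , ≤-refl , x≡
  ... | inj₂ x∈F′ with z , j , z∈F , j≤b , x≡ ← InF⇒scaledOrbit b x∈F′ =
    z , j , z∈F , m≤n⇒m≤1+n j≤b , x≡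

  scaledOrbit⇒InF : ∀ b → ScaledOrbit b x → InF (m * suc m ^ b) x
  scaledOrbit⇒InF b (z , j , z∈F , j≤b , refl) with m≤n⇒m<n∨m≡n j≤b
  ... | inj₂ refl = InF-*q^⁺ j 0<m (cofactorsBelow j) z∈F
  scaledOrbit⇒InF (suc b) (z , j , z∈F , _ , refl) | inj₁ (s≤s j≤b) =
    InF-*q^suc⁺ b (scaledOrbit⇒InF b (z , j , z∈F , j≤b , refl))

  F≡D-*q^ : ∀ b → FeqD (m * suc m ^ b)
  F≡D-*q^ b = F⊆D , D⊆F
    where
    F⊆D : ∀ x → InF (m * suc m ^ b) x → x ∣ m * suc m ^ b
    F⊆D x x∈F with z , j , z∈F , j≤b , refl ← InF⇒scaledOrbit b x∈F =
      *-pres-∣ (proj₁ F≡D z z∈F) (^-monoʳ-∣ (suc m) j≤b)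
    D⊆F : ∀ x → x ∣ m * suc m ^ b → InF (m * suc m ^ b) x
    D⊆F x x∣ with z , j , z∣m , j≤b , x≡ ← ∣*^⇒ b pq m+1∤m x∣ =
      scaledOrbit⇒InF b (z , j , proj₂ F≡D z z∣m , j≤b , x≡)

-- Cofactors of the largest prime factor

coprime-pred : 0 < p → Coprime (p ∸ 1) p
coprime-pred {suc k} _ = Coprime.sym (subst (λ w → Coprime w k) (+-comm k 1) (coprime-+ (1-coprimeTo k)))

module LargestPrimeFactor {m p a} (pp : Prime p) (p∤m : ¬ p ∣ m) (F≡D : FeqD (m * p ^ suc a))
                          (largest : ∀ q → Prime q → q ∣ m * p ^ suc a → q ≤ p) where

  private
    open OrbitOfMultiple pp (suc a)
    instance
      _ = >-nonZero (¬∣⇒>0 p∤m)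
      _ = prime⇒nonZero pp
      _ = m^n≢0 p a
      _ = m^n≢0 p (suc a)

  0<m : 0 < m
  0<m = ¬∣⇒>0 p∤m

  ∣-cofactor : z * p ^ suc a ∣ m * p ^ suc a → z ∣ m
  ∣-cofactor = *-cancelʳ-∣ (p ^ suc a)

  cofactorsBelow : CofactorsBelow m
  cofactorsBelow 1<z z*p^a+1∈F with r , lr ← leastFactor-exists 1<z =
    r , lr , ≤∧≢⇒< (largest r (leastFactor⇒prime lr) (∣m⇒∣m*n (p ^ suc a) r∣m))
                   λ { refl → p∤m r∣m }
    where
    r∣m = ∣-trans (factor lr) (∣-cofactor (proj₁ F≡D _ z*p^a+1∈F))

  F≡D-cofactor : FeqD m
  F≡D-cofactor = F⊆D , D⊆F
    where
    F⊆D : ∀ z → InF m z → z ∣ m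
    F⊆D z z∈F = ∣-cofactor (proj₁ F≡D _ (InF-*q^⁺ 0<m cofactorsBelow z∈F))
    D⊆F : ∀ x → x ∣ m → InF m x
    D⊆F x x∣m with InF-*q^⁻ 0<m cofactorsBelow (proj₂ F≡D _ (*-monoˡ-∣ (p ^ suc a) x∣m))
    ... | inj₁ (z , z∈F , x*p^a+1≡) =
      subst (InF m) (sym (*-cancelʳ-≡ x z (p ^ suc a) x*p^a+1≡)) z∈F
    ... | inj₂ x*p^a+1∈F = subst (InF m) (sym x≡1) (InF-reaches-1 0<m)
      where
      x≤1 : x ≤ 1
      x≤1 = *-cancelʳ-≤ x 1 (p ^ suc a)
              (subst (x * p ^ suc a ≤_) (sym (*-identityˡ _)) (InF-≤ 0<q^j x*p^a+1∈F))
      x≡1 : x ≡ 1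
      x≡1 = ≤-antisym x≤1 (∣⇒>0 0<m x∣m)

  p∸1∣cofactor : p ∸ 1 ∣ m
  p∸1∣cofactor =
    coprime-divisor (coprime-pred (m<n⇒0<n (prime>1 pp))) (subst (p ∸ 1 ∣_) (*-comm m p) p∸1∣m*p)
    where
    [p∸1]*p^a∈F : InF (p ^ suc a) ((p ∸ 1) * p ^ a)
    [p∸1]*p^a∈F = InF-step (prime^suc>1 {j = a} pp) (InF-resp (sym (f-^ {j = a} pp)) InF-start)
    p∸1∣m*p : p ∸ 1 ∣ m * p
    p∸1∣m*p = *-cancelʳ-∣ (p ^ a) (subst ((p ∸ 1) * p ^ a ∣_) (sym (*-assoc m p (p ^ a)))
                (proj₁ F≡D _ (InF-*q^-tail 0<m cofactorsBelow [p∸1]*p^a∈F)))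

  cofactor≤p∸1 : m ≤ p ∸ 1
  cofactor≤p∸1 with InF-*q^⁻ 0<m cofactorsBelow (proj₂ F≡D _ (*-monoʳ-∣ m (^-monoʳ-∣ p (n≤1+n a))))
  ... | inj₁ (z , _ , m*p^a≡z*p^a+1) = contradiction (divides z m≡z*p) p∤m
    where
    m≡z*p = *-cancelʳ-≡ m (z * p) (p ^ a) (trans m*p^a≡z*p^a+1 (sym (*-assoc z p (p ^ a))))
  ... | inj₂ m*p^a∈F with InF-split m*p^a∈F
  ...   | inj₁ m*p^a≡p^a+1 =
    contradiction (∣-reflexive (sym (*-cancelʳ-≡ m p (p ^ a) m*p^a≡p^a+1))) p∤m
  ...   | inj₂ m*p^a∈F′ =
    *-cancelʳ-≤ m (p ∸ 1) (p ^ a) (InF-≤ 0<[p∸1]*p^a (InF-resp (f-^ {j = a} pp) m*p^a∈F′))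
    where 0<[p∸1]*p^a = *-mono-≤ (m<n⇒0<n∸m (prime>1 pp)) (m^n>0 p a)

  suc-cofactor≡p : suc m ≡ p
  suc-cofactor≡p = begin
    suc m         ≡⟨ cong suc (≤-antisym cofactor≤p∸1 (∣⇒≤ p∸1∣cofactor)) ⟩
    suc (p ∸ 1)   ≡⟨ m+[n∸m]≡n (m<n⇒0<n (prime>1 pp)) ⟩
    p             ∎
    where open ≡-Reasoning

F≡D-largestPrime : 1 < n → FeqD n → Prime p → p ∣ n → (∀ q → Prime q → q ∣ n → q ≤ p) →
                   n ≡ c * p → FeqD c × FeqD (n * p)
F≡D-largestPrime {n} {p} {c} 1<n F≡D pp p∣n largest n≡c*p with split-^ pp (m<n⇒0<n 1<n)
... | m , zero , p∤m , n≡m*1 = contradiction (subst (p ∣_) (trans n≡m*1 (*-identityʳ m)) p∣n) p∤m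
... | m , suc a , p∤m , refl
  with LargestPrimeFactor.suc-cofactor≡p {a = a} pp p∤m F≡D largest
... | refl = subst FeqD (sym c≡m*q^a) (F≡D-*q^ a)
           , subst FeqD (*^-suc m (suc m) (suc a)) (F≡D-*q^ (suc (suc a)))
  where
  open SuccessorPrime (LargestPrimeFactor.F≡D-cofactor {a = a} pp p∤m F≡D largest) pp
  c≡m*q^a : c ≡ m * suc m ^ a
  c≡m*q^a = *-cancelʳ-≡ c _ (suc m) (trans (sym n≡c*p) (*^-suc m (suc m) a))

-- Sums over prime power divisors

does⇒ : ∀ {A : Set} (a? : Dec A) → T (does a?) → A
does⇒ (yes a) _ = a

⇒does : ∀ {A : Set} (a? : Dec A) → A → T (does a?)
⇒does (yes _) _ = _
⇒does (no ¬a) a = ¬a a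

n<m^n : 1 < m → ∀ n → n < m ^ n
n<m^n 1<m zero    = z<s
n<m^n {m} 1<m (suc n) = begin
  1 + suc n       ≤⟨ +-mono-≤ (m^n>0 m {{>-nonZero (m<n⇒0<n 1<m)}} n) (n<m^n 1<m n) ⟩
  m ^ n + m ^ n   ≡⟨ cong (m ^ n +_) (+-identityʳ (m ^ n)) ⟨
  2 * m ^ n       ≤⟨ *-monoˡ-≤ (m ^ n) 1<m ⟩
  m * m ^ n       ∎
  where open ≤-Reasoning

isPrimePower⇒ : ∀ e → T (isPrimePower e) → ∃[ p ] ∃[ s ] Prime p × p ^ suc s ≡ e
isPrimePower⇒ e isPP
  with p , p-ok ← satisfied (any⁻ _ (upTo (suc e)) isPP)
  with s , s-ok ← satisfied (any⁻ _ (upTo e) p-ok)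
  with prime-p , p^s+1≡e ← Equivalence.to T-∧ s-ok
  = p , s , does⇒ (prime? p) prime-p , does⇒ (p ^ suc s ≟ e) p^s+1≡e

isPrimePower-^ : Prime p → ∀ s → T (isPrimePower (p ^ suc s))
isPrimePower-^ {p} pp s =
  any⁺ _ (lose (∈-upTo⁺ (s≤s p≤power))
    (any⁺ _ (lose (∈-upTo⁺ s<power)
      (Equivalence.from T-∧ (⇒does (prime? p) pp , ⇒does (power ≟ power) refl)))))
  where
  power = p ^ suc s
  instance _ = prime⇒nonZero pp
  p≤power : p ≤ power
  p≤power = m≤m*n p (p ^ s) {{m^n≢0 p s}}
  s<power : s < power
  s<power = <-trans (n<1+n s) (n<m^n (prime>1 pp) (suc s))

1/_ : ℕ → ℚ
1/ zero    = 0ℚ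
1/ (suc k) = ℤ.+ 1 ℚ./ suc k

recipIf : Bool → ℕ → ℚ
recipIf b e = if b then 1/ e else 0ℚ

sumRecip : (ℕ → Bool) → ℕ → ℚ
sumRecip P zero    = 0ℚ
sumRecip P (suc k) = recipIf (P (suc k)) (suc k) ℚ.+ sumRecip P k

sumRecip-cong : ∀ {P Q} K → (∀ {e} → 0 < e → e ≤ K → P e ≡ Q e) → sumRecip P K ≡ sumRecip Q K
sumRecip-cong zero    _   = refl
sumRecip-cong (suc K) P≗Q = cong₂ (λ b s → recipIf b (suc K) ℚ.+ s) (P≗Q z<s ≤-refl)
  (sumRecip-cong K λ 0<e e≤K → P≗Q 0<e (m≤n⇒m≤1+n e≤K))

sumRecip-beyond : ∀ {P} K K′ → K ≤ K′ → (∀ {e} → K < e → e ≤ K′ → P e ≡ false) →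
                  sumRecip P K′ ≡ sumRecip P K
sumRecip-beyond K zero z≤n _ = refl
sumRecip-beyond {P} K (suc K′) K≤K′+1 none with m≤n⇒m<n∨m≡n K≤K′+1
... | inj₂ refl = refl
... | inj₁ K<K′+1 = begin
  recipIf (P (suc K′)) (suc K′) ℚ.+ sumRecip P K′
    ≡⟨ cong (λ b → recipIf b (suc K′) ℚ.+ sumRecip P K′) (none K<K′+1 ≤-refl) ⟩
  0ℚ ℚ.+ sumRecip P K′                            ≡⟨ ℚ.+-identityˡ _ ⟩
  sumRecip P K′                                   ≡⟨ sumRecip-beyond K K′ (≤-pred K<K′+1) none′ ⟩
  sumRecip P K                                    ∎
  where
  open ≡-Reasoning
  none′ : ∀ {e} → K < e → e ≤ K′ → P e ≡ false
  none′ K<e e≤K′ = none K<e (m≤n⇒m≤1+n e≤K′)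

sumRecip-insert : ∀ {P Q e₀} K → 0 < e₀ → e₀ ≤ K → P e₀ ≡ false → Q e₀ ≡ true →
                  (∀ {e} → 0 < e → e ≤ K → e ≢ e₀ → Q e ≡ P e) →
                  sumRecip Q K ≡ sumRecip P K ℚ.+ 1/ e₀
sumRecip-insert zero 0<e₀ e₀≤0 _ _ _ = contradiction (≤-trans 0<e₀ e₀≤0) λ ()
sumRecip-insert {P} {Q} {e₀} (suc K) 0<e₀ e₀≤K+1 Pe₀ Qe₀ Q≗P with m≤n⇒m<n∨m≡n e₀≤K+1
... | inj₂ refl = begin
  recipIf (Q e₀) e₀ ℚ.+ sumRecip Q K             ≡⟨ cong₂ (λ b s → recipIf b e₀ ℚ.+ s) Qe₀ Q≗P-below ⟩
  1/ e₀ ℚ.+ sumRecip P K                         ≡⟨ ℚ.+-comm (1/ e₀) (sumRecip P K) ⟩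
  sumRecip P K ℚ.+ 1/ e₀                         ≡⟨ cong (ℚ._+ 1/ e₀) (ℚ.+-identityˡ (sumRecip P K)) ⟨
  (0ℚ ℚ.+ sumRecip P K) ℚ.+ 1/ e₀
    ≡⟨ cong (λ b → (recipIf b e₀ ℚ.+ sumRecip P K) ℚ.+ 1/ e₀) Pe₀ ⟨
  (recipIf (P e₀) e₀ ℚ.+ sumRecip P K) ℚ.+ 1/ e₀ ∎
  where
  open ≡-Reasoning
  Q≗P-below : sumRecip Q K ≡ sumRecip P K
  Q≗P-below = sumRecip-cong K λ 0<e e≤K → Q≗P 0<e (m≤n⇒m≤1+n e≤K) (<⇒≢ (s≤s e≤K))
... | inj₁ e₀<K+1 = begin
  recipIf (Q (suc K)) (suc K) ℚ.+ sumRecip Q K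
    ≡⟨ cong₂ (λ b s → recipIf b (suc K) ℚ.+ s) QK+1≡PK+1 IH ⟩
  recipIf (P (suc K)) (suc K) ℚ.+ (sumRecip P K ℚ.+ 1/ e₀)
    ≡⟨ ℚ.+-assoc (recipIf (P (suc K)) (suc K)) (sumRecip P K) (1/ e₀) ⟨
  (recipIf (P (suc K)) (suc K) ℚ.+ sumRecip P K) ℚ.+ 1/ e₀
    ∎
  where
  open ≡-Reasoning
  QK+1≡PK+1 = Q≗P z<s ≤-refl (>⇒≢ e₀<K+1)
  IH = sumRecip-insert K 0<e₀ (≤-pred e₀<K+1) Pe₀ Qe₀ λ 0<e e≤K → Q≗P 0<e (m≤n⇒m≤1+n e≤K)

isPPDivisor : ℕ → ℕ → Bool
isPPDivisor n e = isPrimePower e ∧ does (e ∣? n)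

ppSumUpTo≡sumRecip : ∀ n K → ppSumUpTo n K ≡ sumRecip (isPPDivisor n) K
ppSumUpTo≡sumRecip n zero    = refl
ppSumUpTo≡sumRecip n (suc K) = cong (recipIf (isPPDivisor n (suc K)) (suc K) ℚ.+_) (ppSumUpTo≡sumRecip n K)

isPPDivisor-∤ : ¬ e ∣ n → isPPDivisor n e ≡ false
isPPDivisor-∤ {e} {n} e∤n = trans (cong (isPrimePower e ∧_) (dec-false (e ∣? n) e∤n)) (∧-zeroʳ _)

isPPDivisor-cong : (T (isPrimePower e) → e ∣ n ⇔ e ∣ n′) → isPPDivisor n e ≡ isPPDivisor n′ e
isPPDivisor-cong {e} {n} {n′} same with isPrimePower e
... | false = refl
... | true  = does-⇔ (same _) (e ∣? n) (e ∣? n′)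

primePower∣*q^suc⇒ : Prime r → Prime q → ¬ q ∣ n → r ^ suc s ∣ n * q ^ suc k →
                     r ^ suc s ≢ q ^ suc k → r ^ suc s ∣ n * q ^ k
primePower∣*q^suc⇒ {r} {q} {n} {s} {k} pr pq q∤n e∣ e≢ with ∣*^⇒ (suc k) pq q∤n e∣
... | z , j , z∣n , j≤k+1 , e≡z*q^j with m≤n⇒m<n∨m≡n j≤k+1
...   | inj₁ (s≤s j≤k) = subst (_∣ n * q ^ k) (sym e≡z*q^j) (*-pres-∣ z∣n (^-monoʳ-∣ q j≤k))
...   | inj₂ refl = contradiction e≡z*q^j (e≢*q^k+1 z z∣n)
  where
  e≢*q^k+1 : ∀ z → z ∣ n → r ^ suc s ≢ z * q ^ suc k
  e≢*q^k+1 zero 0∣n _ = contradiction (0∣⇒≡0 0∣n) (>⇒≢ (¬∣⇒>0 q∤n))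
  e≢*q^k+1 1    _   e≡q^k+1 = e≢ (trans e≡q^k+1 (*-identityˡ _))
  e≢*q^k+1 z@(suc (suc _)) z∣n e≡z*q^k+1
    with t , lt ← leastFactor-exists {z} (s≤s (s≤s z≤n)) = contradiction q∣n q∤n
    where
    t≡r : t ≡ r
    t≡r = prime∣^⇒≡ {j = suc s} pr (leastFactor⇒prime lt)
            (subst (t ∣_) (sym e≡z*q^k+1) (∣m⇒∣m*n (q ^ suc k) (factor lt)))
    q≡r : q ≡ r
    q≡r = prime∣^⇒≡ {j = suc s} pr pq
            (subst (q ∣_) (sym e≡z*q^k+1) (∣n⇒∣m*n z (m∣m*n (q ^ k))))
    q∣n : q ∣ n
    q∣n = subst (_∣ n) (trans t≡r (sym q≡r)) (∣-trans (factor lt) z∣n)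

ppSum-*q^suc : Prime q → ¬ q ∣ n → ∀ k →
               ppSum (n * q ^ suc k) ≡ ppSum (n * q ^ k) ℚ.+ 1/ (q ^ suc k)
ppSum-*q^suc {q} {n} pq q∤n k = begin
  ppSum M′                              ≡⟨ ppSumUpTo≡sumRecip M′ M′ ⟩
  sumRecip (isPPDivisor M′) M′
    ≡⟨ sumRecip-insert M′ 0<e₀ (∣⇒≤ e₀∣M′) (isPPDivisor-∤ e₀∤M) e₀∈ agree ⟩
  sumRecip (isPPDivisor M) M′ ℚ.+ 1/ e₀
    ≡⟨ cong (ℚ._+ 1/ e₀) (sumRecip-beyond M M′ (∣⇒≤ M∣M′) beyond) ⟩
  sumRecip (isPPDivisor M) M ℚ.+ 1/ e₀
    ≡⟨ cong (ℚ._+ 1/ e₀) (ppSumUpTo≡sumRecip M M) ⟨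
  ppSum M ℚ.+ 1/ e₀
    ∎
  where
  open ≡-Reasoning
  M = n * q ^ k
  M′ = n * q ^ suc k
  e₀ = q ^ suc k
  instance
    _ = prime⇒nonZero pq
    _ = >-nonZero (¬∣⇒>0 q∤n)
    _ = m^n≢0 q k
    _ = m*n≢0 n (q ^ k)
    _ = m^n≢0 q (suc k)
    _ = m*n≢0 n (q ^ suc k)
  0<e₀ = m^n>0 q (suc k)
  e₀∣M′ : e₀ ∣ M′
  e₀∣M′ = n∣m*n n
  M∣M′ : M ∣ M′
  M∣M′ = *-monoʳ-∣ n (^-monoʳ-∣ q (n≤1+n k))
  e₀∤M : ¬ e₀ ∣ M
  e₀∤M e₀∣M = q∤n (*-cancelʳ-∣ (q ^ k) e₀∣M)
  e₀∈ : isPPDivisor M′ e₀ ≡ true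
  e₀∈ = Equivalence.to T-≡ (Equivalence.from T-∧ (isPrimePower-^ pq k , ⇒does (e₀ ∣? M′) e₀∣M′))
  same-divisibility : ∀ {e} → e ≢ e₀ → T (isPrimePower e) → e ∣ M′ ⇔ e ∣ M
  same-divisibility {e} e≢e₀ isPP with r , s , pr , refl ← isPrimePower⇒ e isPP =
    mk⇔ (λ e∣M′ → primePower∣*q^suc⇒ {s = s} {k = k} pr pq q∤n e∣M′ e≢e₀)
        (λ e∣M → ∣-trans e∣M M∣M′)
  agree : ∀ {e} → 0 < e → e ≤ M′ → e ≢ e₀ → isPPDivisor M′ e ≡ isPPDivisor M e
  agree _ _ e≢e₀ = isPPDivisor-cong (same-divisibility e≢e₀)
  beyond : ∀ {e} → M < e → e ≤ M′ → isPPDivisor M e ≡ false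
  beyond M<e _ = isPPDivisor-∤ (>⇒∤ M<e)

1/+1/≡1/ : ∀ {a b c} → 0 < a → 0 < b → 0 < c → (b + a) * c ≡ a * b → 1/ a ℚ.+ 1/ b ≡ 1/ c
1/+1/≡1/ {suc a} {suc b} {suc c} _ _ _ eq = ℚ.toℚᵘ-injective sum≃
  where
  1/1+ᵘ_ : ℕ → ℚᵘ.ℚᵘ
  1/1+ᵘ k = ℚᵘ.mkℚᵘ (ℤ.+ 1) k
  +1*_ : ℕ → ℤ.ℤ
  +1* k = ℤ.+ 1 ℤ.* ℤ.+ k
  cross-multiplied : (+1* suc b ℤ.+ +1* suc a) ℤ.* ℤ.+ suc c ≡ +1* (suc a * suc b)
  cross-multiplied = begin
    (+1* suc b ℤ.+ +1* suc a) ℤ.* ℤ.+ suc c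
      ≡⟨ cong₂ (λ u v → (u ℤ.+ v) ℤ.* ℤ.+ suc c) (ℤ.*-identityˡ (ℤ.+ suc b)) (ℤ.*-identityˡ (ℤ.+ suc a)) ⟩
    (ℤ.+ suc b ℤ.+ ℤ.+ suc a) ℤ.* ℤ.+ suc c ≡⟨ cong (ℤ._* ℤ.+ suc c) (ℤ.pos-+ (suc b) (suc a)) ⟨
    ℤ.+ (suc b + suc a) ℤ.* ℤ.+ suc c       ≡⟨ ℤ.pos-* (suc b + suc a) (suc c) ⟨
    ℤ.+ ((suc b + suc a) * suc c)           ≡⟨ cong ℤ.+_ eq ⟩
    ℤ.+ (suc a * suc b)                     ≡⟨ ℤ.*-identityˡ _ ⟨
    +1* (suc a * suc b)                     ∎
    where open ≡-Reasoning
  sum≃ : ℚ.toℚᵘ (1/ suc a ℚ.+ 1/ suc b) ℚᵘ.≃ ℚ.toℚᵘ (1/ suc c)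
  sum≃ = begin
    ℚ.toℚᵘ (1/ suc a ℚ.+ 1/ suc b)           ≈⟨ ℚ.toℚᵘ-homo-+ (1/ suc a) (1/ suc b) ⟩
    ℚ.toℚᵘ (1/ suc a) ℚᵘ.+ ℚ.toℚᵘ (1/ suc b) ≈⟨ ℚᵘ.+-cong (ℚ.toℚᵘ-fromℚᵘ (1/1+ᵘ a)) (ℚ.toℚᵘ-fromℚᵘ (1/1+ᵘ b)) ⟩
    1/1+ᵘ a ℚᵘ.+ 1/1+ᵘ b                     ≈⟨ ℚᵘ.*≡* cross-multiplied ⟩
    1/1+ᵘ c                                  ≈⟨ ℚ.toℚᵘ-fromℚᵘ (1/1+ᵘ c) ⟨
    ℚ.toℚᵘ (1/ suc c)                        ∎
    where open ℚᵘ.≃-Reasoning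

-- Prime power pseudoperfect and Giuga numbers

ppPseudoperfect⇔ : 1 < n → PPPseudoperfect n ⇔ (ppSum n ℚ.+ 1/ n ≡ 1ℚ)
ppPseudoperfect⇔ (s≤s (s≤s _)) = mk⇔ id id

ppPseudoperfect⇒>1 : PPPseudoperfect n → 1 < n
ppPseudoperfect⇒>1 {suc (suc _)} _ = s≤s (s≤s z≤n)

ppGiuga-intro : 1 < n → Composite n → ppSum n ℚ.- 1/ n ≡ 1ℚ → PPGiuga n
ppGiuga-intro (s≤s (s≤s _)) n-composite sum≡1 = n-composite , 1 , sum≡1

ppPseudoperfect-*suc^ : PPPseudoperfect n → Prime (suc n) → ∀ k →
                        PPPseudoperfect (n * suc n ^ k)
ppPseudoperfect-*suc^ {n} pseudoperfect pq k =
  Equivalence.from (ppPseudoperfect⇔ (<-≤-trans 1<n (m≤m*n n (suc n ^ k) {{m^n≢0 (suc n) k}})))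
                   (sum≡1 k)
  where
  1<n = ppPseudoperfect⇒>1 pseudoperfect
  q∤n : ¬ suc n ∣ n
  q∤n = >⇒∤ {{>-nonZero (m<n⇒0<n 1<n)}} ≤-refl
  0<n*q^ : ∀ k → 0 < n * suc n ^ k
  0<n*q^ k = *-mono-≤ (m<n⇒0<n 1<n) (m^n>0 (suc n) k)
  sum≡1 : ∀ k → ppSum (n * suc n ^ k) ℚ.+ 1/ (n * suc n ^ k) ≡ 1ℚ
  sum≡1 zero = subst (λ w → ppSum w ℚ.+ 1/ w ≡ 1ℚ) (sym (*-identityʳ n))
                     (Equivalence.to (ppPseudoperfect⇔ 1<n) pseudoperfect)
  sum≡1 (suc k) = begin
    ppSum M′ ℚ.+ 1/ M′            ≡⟨ cong (ℚ._+ 1/ M′) (ppSum-*q^suc pq q∤n k) ⟩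
    (ppSum M ℚ.+ 1/ e₀) ℚ.+ 1/ M′ ≡⟨ ℚ.+-assoc (ppSum M) (1/ e₀) (1/ M′) ⟩
    ppSum M ℚ.+ (1/ e₀ ℚ.+ 1/ M′) ≡⟨ cong (ppSum M ℚ.+_) 1/e₀+1/M′≡1/M ⟩
    ppSum M ℚ.+ 1/ M              ≡⟨ sum≡1 k ⟩
    1ℚ                            ∎
    where
    open ≡-Reasoning
    M = n * suc n ^ k
    M′ = n * suc n ^ suc k
    e₀ = suc n ^ suc k
    identity : ∀ n Q → (n * ((1 + n) * Q) + (1 + n) * Q) * (n * Q) ≡ (1 + n) * Q * (n * ((1 + n) * Q))
    identity = solve-∀
    1/e₀+1/M′≡1/M : 1/ e₀ ℚ.+ 1/ M′ ≡ 1/ M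
    1/e₀+1/M′≡1/M = 1/+1/≡1/ (m^n>0 (suc n) (suc k)) (0<n*q^ (suc k)) (0<n*q^ k) (identity n (suc n ^ k))

ppGiuga-*pred : PPPseudoperfect n → Prime (n ∸ 1) → PPGiuga (n * (n ∸ 1))
ppGiuga-*pred {n@(suc r)} pseudoperfect pr = ppGiuga-intro 1<N N-composite (begin
  ppSum N ℚ.- 1/ N                           ≡⟨ cong (ℚ._- 1/ N) ppSum-N ⟩
  (1/ N ℚ.+ (ppSum n ℚ.+ 1/ n)) ℚ.- 1/ N     ≡⟨ xyx⁻¹≈y (1/ N) (ppSum n ℚ.+ 1/ n) ⟩
  ppSum n ℚ.+ 1/ n                           ≡⟨ Equivalence.to (ppPseudoperfect⇔ (s≤s 0<r)) pseudoperfect ⟩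
  1ℚ                                         ∎)
  where
  open ≡-Reasoning
  N = n * r
  0<r = m<n⇒0<n (prime>1 pr)
  r<N : r < N
  r<N = subst (r <_) (*-comm r n) (m<m*n r n {{>-nonZero 0<r}} (s≤s 0<r))
  1<N = <-trans (prime>1 pr) r<N
  N-composite : Composite N
  N-composite = hasNonTrivialDivisor {{prime⇒nonTrivial pr}} r<N (n∣m*n n)
  r∤n : ¬ r ∣ n
  r∤n r∣n = >⇒≢ (prime>1 pr) (∣1⇒≡1 (∣m+n∣m⇒∣n (subst (r ∣_) (+-comm 1 r) r∣n) ∣-refl))
  ppSum-N : ppSum N ≡ 1/ N ℚ.+ (ppSum n ℚ.+ 1/ n)
  ppSum-N = begin
    ppSum N                         ≡⟨ cong (ppSum ∘ (n *_)) (*-identityʳ r) ⟨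
    ppSum (n * r ^ 1)               ≡⟨ ppSum-*q^suc pr r∤n 0 ⟩
    ppSum (n * r ^ 0) ℚ.+ 1/ (r ^ 1) ≡⟨ cong₂ (λ a b → ppSum a ℚ.+ 1/ b) (*-identityʳ n) (*-identityʳ r) ⟩
    ppSum n ℚ.+ 1/ r                ≡⟨ cong (ppSum n ℚ.+_) (1/+1/≡1/ z<s (<-trans 0<r r<N) 0<r (identity r)) ⟨
    ppSum n ℚ.+ (1/ n ℚ.+ 1/ N)     ≡⟨ ℚ.+-assoc (ppSum n) (1/ n) (1/ N) ⟨
    (ppSum n ℚ.+ 1/ n) ℚ.+ 1/ N     ≡⟨ ℚ.+-comm (ppSum n ℚ.+ 1/ n) (1/ N) ⟩
    1/ N ℚ.+ (ppSum n ℚ.+ 1/ n)     ∎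
    where
    identity : ∀ r → ((1 + r) * r + (1 + r)) * r ≡ (1 + r) * ((1 + r) * r)
    identity = solve-∀

proposition5 : (n : ℕ) → 1 < n →
    ((FeqD n → (p : ℕ) → Prime p → p ∣ n → (∀ q → Prime q → q ∣ n → q ≤ p) →
        (c : ℕ) → n ≡ c * p → FeqD c × FeqD (n * p))
    × (FeqD n → Prime (suc n) → (k : ℕ) → FeqD (n * suc n ^ k))
    × (PPPseudoperfect n → Prime (suc n) → (k : ℕ) → PPPseudoperfect (n * suc n ^ k))
    × (PPPseudoperfect n → Prime (n ∸ 1) → PPGiuga (n * (n ∸ 1))))
proposition5 n 1<n =
    (λ F≡D p pp p∣n largest c → F≡D-largestPrime 1<n F≡D pp p∣n largest)
  , SuccessorPrime.F≡D-*q^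
  , ppPseudoperfect-*suc^
  , ppGiuga-*pred
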